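{- Let $e_J\Theta_n $ be an admissible element of $\mathcal{L}_{n,r}$. Then its differential is \[ \delta(e_J\Theta_n) = \sum_{j_k \in J} (-1)^{k+1} e_{J\setminus \{j_k\}}\Theta_n. \]
   Context: Let $k$ be a commutative ring with unity. Vertices of $Q_n$ are identified with $[2^n]$; $d_H$ is Hamming distance; $\overline{a}$ is the antipodal vertex of $a$. The Stanley--Reisner ideal of $VR(Q_n;r)$ in $k[x_0,\ldots,x_{2^n-1}]$ is generated by $x_ax_b$ with $a<b$, $d_H(a,b)>r$, ordered first by $d_H(a,b)$ and then lexicographically as $m_1<m_2<\cdots$. The Taylor resolution is $k[x_0,\ldots,x_{2^n-1}]\otimes\Lambda(e_1,e_2,\ldots)$ ($e_i=e_{(a,b)}$ corresponding to $m_i=x_ax_b$), with differential $\delta(e_J)=\sum_{i=1}^{|J|}(-1)^{i-1}\frac{m_J}{m_{J\setminus\{j_i\}}}\otimes e_{J\setminus\{j_i\}}$, where $m_J=\operatorname{lcm}(m_j: j\in J)$. An element $e_{i_1}\cdots e_{i_t}$ ($i_1<\cdots<i_t$) is admissible if for every $h$ and every $q>i_h$, $m_q$ does not divide $\operatorname{lcm}(m_{i_1},\ldots,m_{i_h})$. $\mathcal{L}_{n,r}$ is the subcomplex of the Taylor resolution generated by admissible elements, tensored with $k$ over $k[x_0,\ldots,x_{2^n-1}]$ (so coefficients that are non-constant monomials vanish), with induced differential $\delta$. $\Theta_n=\prod_{i=0}^{2^{n-1}-1}e_{(i,\overline{i})}$, and $J$ indexes factors $e_{j_k}$ listed in increasing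 order. -}

module Defs where

open import Data.Nat using (ℕ; zero; suc; _+_; _∸_; _^_; _<_; _≤_; _⊔_; _≡ᵇ_; _/_; _%_)
open import Data.Nat.Properties using (_≟_)
open import Data.Bool using (Bool; true; false; if_then_else_; _∨_)
open import Data.Fin using (Fin; toℕ)
open import Data.Fin.Properties using (all?)
open import Data.List using (List; []; _∷_; _++_; map; length; take; removeAt; upTo; allFin; foldr; zip)
open import Data.List.Properties using () renaming (≡-dec to List-≡-dec)
open import Data.List.Relation.Unary.All using (All)
open import Data.List.Relation.Unary.Linked using (Linked)
open import Data.Product using (_×_; _,_; proj₁; proj₂)
open import Data.Product.Properties using () renaming (≡-dec to ×-≡-dec)
open import Data.Sum using (_⊎_)
open import Relation.Binary.PropositionalEquality using (_≡_)
open import Relation.Nullary using (¬_; does; Dec)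
open import Algebra.Bundles using (CommutativeRing)

-- The hypercube Q_n : vertices are the naturals 0 … 2^n - 1, read in binary.

dH : ℕ → ℕ → ℕ → ℕ
dH zero    a b = 0
dH (suc n) a b = (if (a % 2) ≡ᵇ (b % 2) then 0 else 1) + dH n (a / 2) (b / 2)

-- Antipodal vertex: complement every one of the n bits, i.e. 2^n - 1 - a.
antipode : ℕ → ℕ → ℕ
antipode n a = (2 ^ n ∸ 1) ∸ a

-- A pair (a , b) stands for the monomial x_a x_b / the symbol e_(a,b).
Pair : Set
Pair = ℕ × ℕ

-- (a , b) is a generator of the Stanley–Reisner ideal of VR(Q_n ; r).
IsGen : ℕ → ℕ → Pair → Set
IsGen n r (a , b) = (a < b) × (b < 2 ^ n) × (r < dH n a b)

_≺[_]_ : Pair → ℕ → Pair → Set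
(a , b) ≺[ n ] (a' , b') =
  (dH n a b < dH n a' b') ⊎
  ((dH n a b ≡ dH n a' b') × ((a < a') ⊎ ((a ≡ a') × (b < b'))))

Monomial : ℕ → Set
Monomial n = Fin (2 ^ n) → ℕ

mono : (n : ℕ) → Pair → Monomial n
mono n (a , b) v = if (toℕ v ≡ᵇ a) ∨ (toℕ v ≡ᵇ b) then 1 else 0

Divides : (n : ℕ) → Monomial n → Monomial n → Set
Divides n m m' = ∀ v → m v ≤ m' v

-- m_J = lcm (m_j : j ∈ J)   (lcm of the empty family is 1)
lcmM : (n : ℕ) → List Pair → Monomial n
lcmM n []      v = 0
lcmM n (p ∷ K) v = mono n p v ⊔ lcmM n K v

-- quotient m / m' (used only when m' ∣ m)
quot : (n : ℕ) → Monomial n → Monomial n → Monomial n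
quot n m m' v = m v ∸ m' v

isOne? : (n : ℕ) (m : Monomial n) → Dec (∀ v → m v ≡ 0)
isOne? n m = all? (λ v → m v ≟ 0)

-- Basis elements e_K = e_{i_1} ⋯ e_{i_t} (i_1 < ⋯ < i_t) are represented by
-- the list K of the corresponding generator pairs, in increasing order.

lookupL : (K : List Pair) → Fin (length K) → Pair
lookupL (p ∷ K) Fin.zero    = p
lookupL (p ∷ K) (Fin.suc i) = lookupL K i

Admissible : ℕ → ℕ → List Pair → Set
Admissible n r K =
  (h : Fin (length K)) (q : Pair) → IsGen n r q → lookupL K h ≺[ n ] q →
  ¬ (Divides n (mono n q) (lcmM n (take (suc (toℕ h)) K)))

IsAdmissibleBasis : ℕ → ℕ → List Pair → Set
IsAdmissibleBasis n r K =
  All (IsGen n r) K × Linked (λ p q → p ≺[ n ] q) K × Admissible n r K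

Θ : ℕ → List Pair
Θ n = map (λ i → (i , antipode n i)) (upTo (2 ^ (n ∸ 1)))

-- The complex L_{n,r} = (Lyubeznik-type subcomplex of Taylor) ⊗_S k.

module Complex {c ℓ} (R : CommutativeRing c ℓ) where
  open CommutativeRing R using (Carrier; _≈_; 0#; 1#; -_) renaming (_+_ to _+ᵏ_; _*_ to _*ᵏ_)

  Chain : Set c
  Chain = List (Carrier × List Pair)

  coeff : Chain → List Pair → Carrier
  coeff []            K = 0#
  coeff ((λ' , K') ∷ x) K =
    (if does (List-≡-dec (×-≡-dec _≟_ _≟_) K' K) then λ' else 0#) +ᵏ coeff x K

  _≈ᶜ_ : Chain → Chain → Set ℓ
  x ≈ᶜ y = ∀ K → coeff x K ≈ coeff y K

  sgn : ℕ → Carrier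
  sgn zero    = 1#
  sgn (suc i) = - sgn i

  -- image in k of a monomial coefficient: 1 ↦ 1, non-constant ↦ 0
  evalMono : (n : ℕ) → Monomial n → Carrier
  evalMono n m = if does (isOne? n m) then 1# else 0#

  -- δ(e_K) = Σ_i (-1)^(i-1) (m_K / m_{K∖k_i}) ⊗ e_{K∖k_i}  (i 1-based; below 0-based)
  δ : ℕ → List Pair → Chain
  δ n K = map (λ i → ( sgn (toℕ i) *ᵏ evalMono n (quot n (lcmM n K) (lcmM n (removeAt K i)))
                      , removeAt K i))
              (allFin (length K))

  -- Σ_{j_k ∈ J} (-1)^(k+1) e_{J ∖ {j_k}} Θ_n   (k 1-based; below 0-based)
  rhs : ℕ → List Pair → Chain
  rhs n J = map (λ i → (sgn (toℕ i) , removeAt J i ++ Θ n)) (allFin (length J))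

-- The monomials x_a x_b are squarefree, so an lcm of them is the indicator of the set of vertices
-- it covers, and m_K / m_L is the constant 1 exactly when every vertex covered by K is covered by L.
-- The pairs (t , t̄), t < 2^(n-1), of Θ_n partition the vertices of Q_n.  Deleting a factor of J
-- therefore keeps Θ_n, which covers everything, and the coefficient is 1.  Deleting the factor
-- (t , t̄) of Θ_n uncovers t and t̄ in Θ_n, and admissibility (x_t x_t̄ does not divide the lcm of
-- the factors preceding it) forces J to miss one of them: the coefficient is a non-constant monomial,
-- which vanishes in k.
module Submission where

open import Defs
open import Algebra.Bundles using (CommutativeRing)
open import Data.Bool using (true; false; if_then_else_; _∨_; T)
open import Data.Empty using (⊥-elim)
open import Data.Fin using (Fin; toℕ; fromℕ<; inject₁) renaming (zero to fzero; suc to fsuc)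
open import Data.Fin.Properties using (toℕ-fromℕ<; toℕ<n; toℕ-inject₁; toℕ-injective; ¬∀⟶∃¬)
  renaming (suc-injective to fsuc-injective)
open import Data.List using (List; []; _∷_; _++_; map; length; take; removeAt; upTo; applyUpTo; tabulate)
open import Data.List.Properties using (length-map; length-upTo; map-tabulate)
open import Data.List.Relation.Unary.All using (All; _∷_; head)
open import Data.List.Relation.Unary.All.Properties using (++⁻ʳ)
open import Data.List.Relation.Unary.Linked using (Linked; _∷_)
open import Data.Nat
  using (ℕ; zero; suc; _+_; _∸_; _^_; _≤_; _<_; _⊔_; _≡ᵇ_; _≤?_; _<?_; z≤n; s≤s; z<s)
open import Data.Nat.Properties
open import Data.Product using (_×_; _,_; proj₁; proj₂; ∃)
open import Data.Sum using (_⊎_; inj₁; inj₂)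
open import Function using (_∘_)
open import Level using (Level)
open import Relation.Binary.PropositionalEquality
  using (_≡_; _≢_; refl; sym; trans; cong; cong₂; subst; subst₂)
open import Relation.Nullary using (¬_; yes; no; contradiction)
open import Relation.Nullary.Decidable using (dec-true; dec-false)

private
  variable
    ℓ : Level
    X : Set ℓ
    n m r : ℕ

mono-endpoint : ∀ {a b} {v : Fin (2 ^ n)} → toℕ v ≡ a ⊎ toℕ v ≡ b → mono n (a , b) v ≡ 1
mono-endpoint {a = a} {b} {v} endpoint with toℕ v ≡ᵇ a in va | toℕ v ≡ᵇ b in vb
... | true  | _    = refl
... | false | true = refl
... | false | false with endpoint
...   | inj₁ v≡a = ⊥-elim (subst T va (≡⇒≡ᵇ _ _ v≡a))
...   | inj₂ v≡b = ⊥-elim (subst T vb (≡⇒≡ᵇ _ _ v≡b))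

mono≢0⇒endpoint : ∀ {a b} {v : Fin (2 ^ n)} → mono n (a , b) v ≢ 0 → toℕ v ≡ a ⊎ toℕ v ≡ b
mono≢0⇒endpoint {a = a} {b} {v} nonzero with toℕ v ≡ᵇ a in va | toℕ v ≡ᵇ b in vb
... | true  | _     = inj₁ (≡ᵇ⇒≡ _ _ (subst T (sym va) _))
... | false | true  = inj₂ (≡ᵇ⇒≡ _ _ (subst T (sym vb) _))
... | false | false = contradiction refl nonzero

mono≤1 : ∀ p (v : Fin (2 ^ n)) → mono n p v ≤ 1
mono≤1 {n} (a , b) v with (toℕ v ≡ᵇ a) ∨ (toℕ v ≡ᵇ b)
... | true  = ≤-refl
... | false = z≤n

lcmM≤1 : ∀ K (v : Fin (2 ^ n)) → lcmM n K v ≤ 1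
lcmM≤1 []      v = z≤n
lcmM≤1 {n} (p ∷ K) v = ⊔-lub (mono≤1 {n} p v) (lcmM≤1 K v)

lcmM-++ : ∀ A B (v : Fin (2 ^ n)) → lcmM n (A ++ B) v ≡ lcmM n A v ⊔ lcmM n B v
lcmM-++ []      B v = refl
lcmM-++ {n} (p ∷ A) B v =
  trans (cong (mono n p v ⊔_) (lcmM-++ A B v)) (sym (⊔-assoc (mono n p v) (lcmM n A v) (lcmM n B v)))

lcmM-++ˡ : ∀ A B (v : Fin (2 ^ n)) → lcmM n A v ≤ lcmM n (A ++ B) v
lcmM-++ˡ {n} A B v = subst (lcmM n A v ≤_) (sym (lcmM-++ A B v)) (m≤m⊔n _ _)

lcmM-++ʳ : ∀ A B (v : Fin (2 ^ n)) → lcmM n B v ≤ lcmM n (A ++ B) v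
lcmM-++ʳ {n} A B v = subst (lcmM n B v ≤_) (sym (lcmM-++ A B v)) (m≤n⊔m _ _)

mono≤lcmM : ∀ K i (v : Fin (2 ^ n)) → mono n (lookupL K i) v ≤ lcmM n K v
mono≤lcmM (p ∷ K) fzero    v = m≤m⊔n _ _
mono≤lcmM (p ∷ K) (fsuc i) v = ≤-trans (mono≤lcmM K i v) (m≤n⊔m _ _)

lcmM≡0 : ∀ K (v : Fin (2 ^ n)) → (∀ i → mono n (lookupL K i) v ≡ 0) → lcmM n K v ≡ 0
lcmM≡0 []      v absent = refl
lcmM≡0 (p ∷ K) v absent = cong₂ _⊔_ (absent fzero) (lcmM≡0 K v (absent ∘ fsuc))

lcmM-removeAt≡0 : ∀ K j (v : Fin (2 ^ n)) → (∀ i → i ≢ j → mono n (lookupL K i) v ≡ 0) →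
                  lcmM n (removeAt K j) v ≡ 0
lcmM-removeAt≡0 (p ∷ K) fzero    v absent = lcmM≡0 K v (λ i → absent (fsuc i) λ ())
lcmM-removeAt≡0 (p ∷ K) (fsuc j) v absent =
  cong₂ _⊔_ (absent fzero λ ())
            (lcmM-removeAt≡0 K j v (λ i i≢j → absent (fsuc i) (i≢j ∘ fsuc-injective)))

inj++ˡ : ∀ (A B : List X) → Fin (length A) → Fin (length (A ++ B))
inj++ˡ (x ∷ A) B fzero    = fzero
inj++ˡ (x ∷ A) B (fsuc i) = fsuc (inj++ˡ A B i)

inj++ʳ : ∀ (A B : List X) → Fin (length B) → Fin (length (A ++ B))
inj++ʳ []      B j = j
inj++ʳ (x ∷ A) B j = fsuc (inj++ʳ A B j)

toℕ-inj++ˡ : ∀ (A B : List X) i → toℕ (inj++ˡ A B i) ≡ toℕ i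
toℕ-inj++ˡ (x ∷ A) B fzero    = refl
toℕ-inj++ˡ (x ∷ A) B (fsuc i) = cong suc (toℕ-inj++ˡ A B i)

removeAt-inj++ˡ : ∀ (A B : List X) i → removeAt (A ++ B) (inj++ˡ A B i) ≡ removeAt A i ++ B
removeAt-inj++ˡ (x ∷ A) B fzero    = refl
removeAt-inj++ˡ (x ∷ A) B (fsuc i) = cong (x ∷_) (removeAt-inj++ˡ A B i)

removeAt-inj++ʳ : ∀ (A B : List X) j → removeAt (A ++ B) (inj++ʳ A B j) ≡ A ++ removeAt B j
removeAt-inj++ʳ []      B j = refl
removeAt-inj++ʳ (x ∷ A) B j = cong (x ∷_) (removeAt-inj++ʳ A B j)

take-inj++ʳ : ∀ (A B : List X) j → take (toℕ (inj++ʳ A B j)) (A ++ B) ≡ A ++ take (toℕ j) B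
take-inj++ʳ []      B j = refl
take-inj++ʳ (x ∷ A) B j = cong (x ∷_) (take-inj++ʳ A B j)

lookupL-inj++ʳ : ∀ A B j → lookupL (A ++ B) (inj++ʳ A B j) ≡ lookupL B j
lookupL-inj++ʳ []      B j = refl
lookupL-inj++ʳ (x ∷ A) B j = lookupL-inj++ʳ A B j

All-lookupL : ∀ {P : Pair → Set ℓ} {K} → All P K → ∀ i → P (lookupL K i)
All-lookupL (px ∷ _)   fzero    = px
All-lookupL (_  ∷ pxs) (fsuc i) = All-lookupL pxs i

Linked-lookupL : ∀ {R : Pair → Pair → Set ℓ} {p K} → Linked R (p ∷ K) →
                 ∀ i → R (lookupL (p ∷ K) (inject₁ i)) (lookupL K i)
Linked-lookupL (Rpq ∷ _)      fzero    = Rpq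
Linked-lookupL (_   ∷ linked) (fsuc i) = Linked-lookupL linked i

Divides-lcmM-++ˡ : ∀ {μ : Monomial n} A B → Divides n μ (lcmM n A) → Divides n μ (lcmM n (A ++ B))
Divides-lcmM-++ˡ A B divides v = ≤-trans (divides v) (lcmM-++ˡ A B v)

¬Divides⇒∃< : ∀ {μ μ' : Monomial n} → ¬ Divides n μ μ' → ∃ λ v → μ' v < μ v
¬Divides⇒∃< {n} {μ} {μ'} ¬divides with ¬∀⟶∃¬ (2 ^ n) _ (λ v → μ v ≤? μ' v) ¬divides
... | v , μv≰μ'v = v , ≰⇒> μv≰μ'v

admissible⇒¬divides-prefix : ∀ {K} → IsAdmissibleBasis n r K → (i : Fin (length K)) →
                             ¬ Divides n (mono n (lookupL K i)) (lcmM n (take (toℕ i) K))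
-- Admissibility constrains only the later factors; the first one is a non-constant monomial, which
-- does not divide the empty lcm 1.
admissible⇒¬divides-prefix {n} {K = (a , b) ∷ K} ((_ , b<2ⁿ , _) ∷ _ , _) fzero divides =
  1+n≰n (subst (_≤ 0) (mono-endpoint {n} (inj₂ (toℕ-fromℕ< b<2ⁿ))) (divides (fromℕ< b<2ⁿ)))
admissible⇒¬divides-prefix {n} {K = p ∷ K} (gens , linked , admissible) (fsuc i) =
  subst (λ k → ¬ Divides n (mono n (lookupL K i)) (lcmM n (take (suc k) (p ∷ K)))) (toℕ-inject₁ i)
    (admissible (inject₁ i) (lookupL K i) (All-lookupL gens (fsuc i)) (Linked-lookupL linked i))

admissible-++⇒uncovered : ∀ {J T} → IsAdmissibleBasis n r (J ++ T) → (j : Fin (length T)) →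
                          ∃ λ v → mono n (lookupL T j) v ≢ 0 × lcmM n J v ≡ 0
admissible-++⇒uncovered {n} {J = J} {T} basis j =
  let v , lcmJ<mono = ¬Divides⇒∃< {n} ¬divides
  in  v , (λ mono≡0 → n≮0 (subst (lcmM n J v <_) mono≡0 lcmJ<mono))
        , n<1⇒n≡0 (<-≤-trans lcmJ<mono (mono≤1 {n} (lookupL T j) v))
  where
  ¬divides : ¬ Divides n (mono n (lookupL T j)) (lcmM n J)
  ¬divides divides = admissible⇒¬divides-prefix basis (inj++ʳ J T j)
    (subst₂ (λ q L → Divides n (mono n q) (lcmM n L)) (sym (lookupL-inj++ʳ J T j)) (sym (take-inj++ʳ J T j))
      (Divides-lcmM-++ˡ J (take (toℕ j) T) divides))

antipode-involutive : ∀ n {x} → x < 2 ^ n → antipode n (antipode n x) ≡ x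
antipode-involutive n x<2ⁿ = m∸[m∸n]≡n (∸-monoˡ-≤ 1 x<2ⁿ)

antipode-injective : ∀ n {x y} → x < 2 ^ n → y < 2 ^ n → antipode n x ≡ antipode n y → x ≡ y
antipode-injective n x<2ⁿ y<2ⁿ eq =
  trans (sym (antipode-involutive n x<2ⁿ)) (trans (cong (antipode n) eq) (antipode-involutive n y<2ⁿ))

antipode-lowerHalf : ∀ m {t} → t < 2 ^ m → 2 ^ m ≤ antipode (suc m) t
antipode-lowerHalf m {t} t<P = begin
  P                    ≤⟨ m≤m+n P _ ⟩
  P + (P + 0 ∸ suc t)  ≡⟨ sym (+-∸-assoc P (subst (suc t ≤_) (sym (+-identityʳ P)) t<P)) ⟩
  P + (P + 0) ∸ suc t  ≡⟨ sym (∸-+-assoc (P + (P + 0)) 1 t) ⟩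
  antipode (suc m) t   ∎
  where
  P = 2 ^ m
  open ≤-Reasoning

antipode-upperHalf : ∀ m {x} → 2 ^ m ≤ x → x < 2 ^ suc m → antipode (suc m) x < 2 ^ m
antipode-upperHalf m {x} P≤x x<2P = m<n+o⇒m∸n<o (2 ^ suc m ∸ 1) x {{m^n≢0 2 m}} (begin-strict
  2 ^ suc m ∸ 1  <⟨ ∸-monoʳ-< {2 ^ suc m} {1} {0} z<s (≤-trans (s≤s z≤n) x<2P) ⟩
  P + (P + 0)    ≡⟨ cong (P +_) (+-identityʳ P) ⟩
  P + P          ≤⟨ +-monoʳ-≤ P P≤x ⟩
  P + x          ≡⟨ +-comm P x ⟩
  x + P          ∎)
  where
  P = 2 ^ m
  open ≤-Reasoning

antipodalPairs-disjoint : ∀ m {s t x} → s < 2 ^ m → t < 2 ^ m →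
                          x ≡ s ⊎ x ≡ antipode (suc m) s → x ≡ t ⊎ x ≡ antipode (suc m) t → s ≡ t
antipodalPairs-disjoint m s<P t<P (inj₁ x≡s) (inj₁ x≡t) = trans (sym x≡s) x≡t
antipodalPairs-disjoint m s<P t<P (inj₁ x≡s) (inj₂ x≡t̄) =
  contradiction (subst (_ ≤_) (trans (sym x≡t̄) x≡s) (antipode-lowerHalf m t<P)) (<⇒≱ s<P)
antipodalPairs-disjoint m s<P t<P (inj₂ x≡s̄) (inj₁ x≡t) =
  contradiction (subst (_ ≤_) (trans (sym x≡s̄) x≡t) (antipode-lowerHalf m s<P)) (<⇒≱ t<P)
antipodalPairs-disjoint m s<P t<P (inj₂ x≡s̄) (inj₂ x≡t̄) =
  antipode-injective (suc m) (<-≤-trans s<P (m≤m+n _ _)) (<-≤-trans t<P (m≤m+n _ _)) (trans (sym x≡s̄) x≡t̄)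

lookupL-map-applyUpTo : ∀ (g : ℕ → Pair) f k j → lookupL (map g (applyUpTo f k)) j ≡ g (f (toℕ j))
lookupL-map-applyUpTo g f (suc k) fzero    = refl
lookupL-map-applyUpTo g f (suc k) (fsuc j) = lookupL-map-applyUpTo g (f ∘ suc) k j

Θ-length : ∀ m → length (Θ (suc m)) ≡ 2 ^ m
Θ-length m = trans (length-map _ (upTo (2 ^ m))) (length-upTo (2 ^ m))

Θ-lookup : ∀ m j → lookupL (Θ (suc m)) j ≡ (toℕ j , antipode (suc m) (toℕ j))
Θ-lookup m = lookupL-map-applyUpTo _ (λ i → i) (2 ^ m)

Θ-index< : ∀ m (j : Fin (length (Θ (suc m)))) → toℕ j < 2 ^ m
Θ-index< m j = subst (toℕ j <_) (Θ-length m) (toℕ<n j)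

Θ-covers-pair : ∀ m {t} (v : Fin (2 ^ suc m)) → t < 2 ^ m → toℕ v ≡ t ⊎ toℕ v ≡ antipode (suc m) t →
                1 ≤ lcmM (suc m) (Θ (suc m)) v
Θ-covers-pair m {t} v t<P endpoint = begin
  1                                    ≡⟨ sym (mono-endpoint {suc m} endpoint) ⟩
  mono (suc m) (t , antipode (suc m) t) v ≡⟨ cong (λ q → mono (suc m) q v) (sym lookup-j) ⟩
  mono (suc m) (lookupL (Θ (suc m)) j) v  ≤⟨ mono≤lcmM (Θ (suc m)) j v ⟩
  lcmM (suc m) (Θ (suc m)) v            ∎
  where
  open ≤-Reasoning
  j = fromℕ< (subst (t <_) (sym (Θ-length m)) t<P)
  lookup-j : lookupL (Θ (suc m)) j ≡ (t , antipode (suc m) t)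
  lookup-j = trans (Θ-lookup m j) (cong (λ s → s , antipode (suc m) s) (toℕ-fromℕ< _))

Θ-covers : ∀ m (v : Fin (2 ^ suc m)) → 1 ≤ lcmM (suc m) (Θ (suc m)) v
Θ-covers m v with toℕ v <? 2 ^ m
... | yes v<P = Θ-covers-pair m v v<P (inj₁ refl)
... | no  v≮P = Θ-covers-pair m v (antipode-upperHalf m (≮⇒≥ v≮P) (toℕ<n v))
                  (inj₂ (sym (antipode-involutive (suc m) (toℕ<n v))))

Θ-pairs-disjoint : ∀ m {i j} {v : Fin (2 ^ suc m)} →
                   mono (suc m) (lookupL (Θ (suc m)) i) v ≢ 0 →
                   mono (suc m) (lookupL (Θ (suc m)) j) v ≢ 0 → i ≡ j
Θ-pairs-disjoint m {i} {j} {v} vᵢ≢0 vⱼ≢0 = toℕ-injective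
  (antipodalPairs-disjoint m (Θ-index< m i) (Θ-index< m j) (endpoint i vᵢ≢0) (endpoint j vⱼ≢0))
  where
  endpoint : ∀ k → mono (suc m) (lookupL (Θ (suc m)) k) v ≢ 0 →
             toℕ v ≡ toℕ k ⊎ toℕ v ≡ antipode (suc m) (toℕ k)
  endpoint k = mono≢0⇒endpoint {suc m} ∘ subst (λ q → mono (suc m) q v ≢ 0) (Θ-lookup m k)

Θ-removeAt-uncovers : ∀ m j {v : Fin (2 ^ suc m)} → mono (suc m) (lookupL (Θ (suc m)) j) v ≢ 0 →
                      lcmM (suc m) (removeAt (Θ (suc m)) j) v ≡ 0
Θ-removeAt-uncovers m j {v} vⱼ≢0 = lcmM-removeAt≡0 (Θ (suc m)) j v absent
  where
  absent : ∀ i → i ≢ j → mono (suc m) (lookupL (Θ (suc m)) i) v ≡ 0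
  absent i i≢j with mono (suc m) (lookupL (Θ (suc m)) i) v ≟ 0
  ... | yes vᵢ≡0 = vᵢ≡0
  ... | no  vᵢ≢0 = contradiction (Θ-pairs-disjoint m {v = v} vᵢ≢0 vⱼ≢0) i≢j

quot-lcmM-covering-isOne : ∀ K L → (∀ v → 1 ≤ lcmM n L v) → ∀ v → quot n (lcmM n K) (lcmM n L) v ≡ 0
quot-lcmM-covering-isOne K L covering v = m≤n⇒m∸n≡0 (≤-trans (lcmM≤1 K v) (covering v))

quot-lcmM-removeAt-Θ-notOne : ∀ m J → IsAdmissibleBasis (suc m) r (J ++ Θ (suc m)) → ∀ j →
  ¬ (∀ v → quot (suc m) (lcmM (suc m) (J ++ Θ (suc m))) (lcmM (suc m) (J ++ removeAt (Θ (suc m)) j)) v ≡ 0)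
quot-lcmM-removeAt-Θ-notOne {r} m J basis j isOne
  with admissible-++⇒uncovered {suc m} {r} {J} {Θ (suc m)} basis j
... | v , vⱼ≢0 , lcmJ≡0 = 1+n≰n (begin
  1                              ≤⟨ n≢0⇒n>0 vⱼ≢0 ⟩
  mono (suc m) (lookupL Θₙ j) v  ≤⟨ mono≤lcmM Θₙ j v ⟩
  lcmM (suc m) Θₙ v              ≤⟨ lcmM-++ʳ J Θₙ v ⟩
  lcmM (suc m) (J ++ Θₙ) v       ≡⟨ cong (lcmM (suc m) (J ++ Θₙ) v ∸_) lcm-removed≡0 ⟨
  lcmM (suc m) (J ++ Θₙ) v ∸ lcmM (suc m) (J ++ removeAt Θₙ j) v
                                 ≡⟨ isOne v ⟩
  0                              ∎)
  where
  open ≤-Reasoning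
  Θₙ = Θ (suc m)
  lcm-removed≡0 : lcmM (suc m) (J ++ removeAt Θₙ j) v ≡ 0
  lcm-removed≡0 =
    trans (lcmM-++ J (removeAt Θₙ j) v) (cong₂ _⊔_ lcmJ≡0 (Θ-removeAt-uncovers m j vⱼ≢0))

module _ {c ℓ} (R : CommutativeRing c ℓ) where
  open CommutativeRing R using (Carrier; _≈_; 0#; 1#; setoid)
    renaming ( _*_ to _*ᵏ_; +-cong to +ᵏ-cong; +-identityˡ to +ᵏ-identityˡ
             ; *-identityʳ to *ᵏ-identityʳ; zeroʳ to *ᵏ-zeroʳ; refl to ≈-refl; trans to ≈-trans)
  open Complex R
  open import Relation.Binary.Reasoning.Setoid setoid

  evalMono-≡1# : ∀ {μ : Monomial n} → (∀ v → μ v ≡ 0) → evalMono n μ ≡ 1#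
  evalMono-≡1# {n} {μ} isOne rewrite dec-true (isOne? n μ) isOne = refl

  evalMono-≡0# : ∀ {μ : Monomial n} → ¬ (∀ v → μ v ≡ 0) → evalMono n μ ≡ 0#
  evalMono-≡0# {n} {μ} notOne rewrite dec-false (isOne? n μ) notOne = refl

  if-then-0#-cong : ∀ b {x y} → x ≈ y → (if b then x else 0#) ≈ (if b then y else 0#)
  if-then-0#-cong true  x≈y = x≈y
  if-then-0#-cong false _   = ≈-refl

  if-then-0#-≈0# : ∀ b {x} → x ≈ 0# → (if b then x else 0#) ≈ 0#
  if-then-0#-≈0# true  x≈0 = x≈0
  if-then-0#-≈0# false _   = ≈-refl

  coeff-∷-cong : ∀ {e e' : Carrier × List Pair} x y K → proj₁ e ≈ proj₁ e' → proj₂ e ≡ proj₂ e' →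
                 coeff x K ≈ coeff y K → coeff (e ∷ x) K ≈ coeff (e' ∷ y) K
  coeff-∷-cong x y K λ≈λ' refl rest = +ᵏ-cong (if-then-0#-cong _ λ≈λ') rest

  coeff-tabulate-≈0# : ∀ {N} (f : Fin N → Carrier × List Pair) → (∀ j → proj₁ (f j) ≈ 0#) →
                       ∀ K → coeff (tabulate f) K ≈ 0#
  coeff-tabulate-≈0# {zero}  f zeros K = ≈-refl
  coeff-tabulate-≈0# {suc N} f zeros K =
    ≈-trans (+ᵏ-cong (if-then-0#-≈0# _ (zeros fzero)) (coeff-tabulate-≈0# (f ∘ fsuc) (zeros ∘ fsuc) K))
            (+ᵏ-identityˡ 0#)

  tabulate-++-≈ᶜ : ∀ (A B : List Pair) (f : Fin (length (A ++ B)) → Carrier × List Pair)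
                   (g : Fin (length A) → Carrier × List Pair) →
                   (∀ i → proj₁ (f (inj++ˡ A B i)) ≈ proj₁ (g i)) →
                   (∀ i → proj₂ (f (inj++ˡ A B i)) ≡ proj₂ (g i)) →
                   (∀ j → proj₁ (f (inj++ʳ A B j)) ≈ 0#) →
                   tabulate f ≈ᶜ tabulate g
  tabulate-++-≈ᶜ []      B f g _      _     zeros K = coeff-tabulate-≈0# f zeros K
  tabulate-++-≈ᶜ (x ∷ A) B f g coeffs bases zeros K =
    coeff-∷-cong (tabulate (f ∘ fsuc)) (tabulate (g ∘ fsuc)) K (coeffs fzero) (bases fzero)
      (tabulate-++-≈ᶜ A B (f ∘ fsuc) (g ∘ fsuc) (coeffs ∘ fsuc) (bases ∘ fsuc) zeros K)

  quotCoeff : ∀ n → List Pair → List Pair → Carrier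
  quotCoeff n K L = evalMono n (quot n (lcmM n K) (lcmM n L))

  δ-term : ∀ n K → Fin (length K) → Carrier × List Pair
  δ-term n K i = sgn (toℕ i) *ᵏ quotCoeff n K (removeAt K i) , removeAt K i

  rhs-term : ∀ n J → Fin (length J) → Carrier × List Pair
  rhs-term n J i = sgn (toℕ i) , removeAt J i ++ Θ n

  δ-tabulate : ∀ n K → δ n K ≡ tabulate (δ-term n K)
  δ-tabulate n K = map-tabulate (λ i → i) (δ-term n K)

  rhs-tabulate : ∀ n J → rhs n J ≡ tabulate (rhs-term n J)
  rhs-tabulate n J = map-tabulate (λ i → i) (rhs-term n J)

  δ-term-inj++ˡ : ∀ m J i → proj₁ (δ-term (suc m) (J ++ Θ (suc m)) (inj++ˡ J (Θ (suc m)) i)) ≈ sgn (toℕ i)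
  δ-term-inj++ˡ m J i = begin
    sgn (toℕ (inj++ˡ J Θₙ i)) *ᵏ quotCoeff (suc m) (J ++ Θₙ) (removeAt (J ++ Θₙ) (inj++ˡ J Θₙ i))
      ≡⟨ cong₂ (λ k L → sgn k *ᵏ quotCoeff (suc m) (J ++ Θₙ) L) (toℕ-inj++ˡ J Θₙ i) (removeAt-inj++ˡ J Θₙ i) ⟩
    sgn (toℕ i) *ᵏ quotCoeff (suc m) (J ++ Θₙ) (removeAt J i ++ Θₙ)
      ≡⟨ cong (sgn (toℕ i) *ᵏ_) (evalMono-≡1# {suc m} isOne) ⟩
    sgn (toℕ i) *ᵏ 1#
      ≈⟨ *ᵏ-identityʳ _ ⟩
    sgn (toℕ i) ∎
    where
    Θₙ = Θ (suc m)
    isOne : ∀ v → quot (suc m) (lcmM (suc m) (J ++ Θₙ)) (lcmM (suc m) (removeAt J i ++ Θₙ)) v ≡ 0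
    isOne = quot-lcmM-covering-isOne (J ++ Θₙ) (removeAt J i ++ Θₙ)
              (λ v → ≤-trans (Θ-covers m v) (lcmM-++ʳ (removeAt J i) Θₙ v))

  δ-term-inj++ʳ : ∀ m J → IsAdmissibleBasis (suc m) r (J ++ Θ (suc m)) →
                  ∀ j → proj₁ (δ-term (suc m) (J ++ Θ (suc m)) (inj++ʳ J (Θ (suc m)) j)) ≈ 0#
  δ-term-inj++ʳ m J basis j = begin
    sgn k *ᵏ quotCoeff (suc m) (J ++ Θₙ) (removeAt (J ++ Θₙ) (inj++ʳ J Θₙ j))
      ≡⟨ cong (λ L → sgn k *ᵏ quotCoeff (suc m) (J ++ Θₙ) L) (removeAt-inj++ʳ J Θₙ j) ⟩
    sgn k *ᵏ quotCoeff (suc m) (J ++ Θₙ) (J ++ removeAt Θₙ j)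
      ≡⟨ cong (sgn k *ᵏ_) (evalMono-≡0# {suc m} (quot-lcmM-removeAt-Θ-notOne m J basis j)) ⟩
    sgn k *ᵏ 0#
      ≈⟨ *ᵏ-zeroʳ _ ⟩
    0# ∎
    where
    Θₙ = Θ (suc m)
    k = toℕ (inj++ʳ J Θₙ j)

mainTheorem8 : ∀ {c ℓ} (R : CommutativeRing c ℓ) (n r : ℕ) (J : List Pair) →
    IsAdmissibleBasis n r (J ++ Θ n) →
    Complex._≈ᶜ_ R (Complex.δ R n (J ++ Θ n)) (Complex.rhs R n J)
-- Θ 0 is e_(0,0), and (0 , 0) is not a generator.
mainTheorem8 R zero    r J (gens , _) = ⊥-elim (<-irrefl refl (proj₁ (head (++⁻ʳ J gens))))
mainTheorem8 R (suc m) r J basis K    = begin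
  coeff (δ (suc m) (J ++ Θₙ)) K
    ≡⟨ cong (λ x → coeff x K) (δ-tabulate R (suc m) (J ++ Θₙ)) ⟩
  coeff (tabulate (δ-term R (suc m) (J ++ Θₙ))) K
    ≈⟨ tabulate-++-≈ᶜ R J Θₙ _ _ (δ-term-inj++ˡ R m J) (removeAt-inj++ˡ J Θₙ) (δ-term-inj++ʳ R m J basis) K ⟩
  coeff (tabulate (rhs-term R (suc m) J)) K
    ≡⟨ cong (λ x → coeff x K) (rhs-tabulate R (suc m) J) ⟨
  coeff (rhs (suc m) J) K
    ∎
  where
  Θₙ = Θ (suc m)
  open Complex R
  open import Relation.Binary.Reasoning.Setoid (CommutativeRing.setoid R)
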